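{- Let $s>1$ and $t>1$ be integers and let $\alpha_{s,t}$ be the type-$\alpha$ comb with $s$ teeth of length $t$. Then no linear extension of $\alpha_{s,t}$ avoids the pattern $123$; i.e., the number of $123$-avoiding linear extensions of $\alpha_{s,t}$ is $0$.
   Context: A linear extension of a finite poset $P$ on a set of integers is a listing $v=[v_1,\dots,v_n]$ of all elements of $P$, each exactly once, such that whenever $a \leq_P b$, $a$ appears before $b$. For $w \in S_3$, a sequence $v$ of distinct integers contains $w$ if there are indices $i<j<k$ with $(v_i,v_j,v_k)$ in the same relative order as $(w_1,w_2,w_3)$; otherwise $v$ avoids $w$. The type-$\alpha$ comb $\alpha_{s,t}$ is the poset on $\{1,\dots,st\}$ whose order is generated by the relations $i \leq i+1$ for $1 \leq i \leq s-1$ (the spine $1,\dots,s$) and $x \leq x+s$ for $1 \leq x \leq (t-1)s$ (so the teeth are $c, c+s, \dots, c+(t-1)s$ for $1\le c\le s$). -}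

module Defs where

open import Data.Nat using (ℕ; suc; _+_; _*_; _∸_; _≤_; _<_)
open import Data.Fin using (Fin; zero; suc)
open import Data.List using (List; length; lookup)
open import Data.List.Membership.Propositional using (_∈_)
open import Data.List.Relation.Unary.Unique.Propositional using (Unique)
open import Data.Product using (_×_; ∃-syntax)
open import Function.Bundles using (_⇔_)
open import Relation.Binary.PropositionalEquality using (_≡_; _≢_)
open import Relation.Binary.Construct.Closure.ReflexiveTransitive using (Star)
open import Relation.Nullary using (¬_)
import Data.Fin as F

data CombGen (s t : ℕ) : ℕ → ℕ → Set where
  spine : ∀ {i} → 1 ≤ i → i ≤ s ∸ 1 → CombGen s t i (suc i)
  tooth : ∀ {x} → 1 ≤ x → x ≤ (t ∸ 1) * s → CombGen s t x (x + s)

_≼[_,_]_ : ℕ → ℕ → ℕ → ℕ → Set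
a ≼[ s , t ] b = Star (CombGen s t) a b

Before : List ℕ → ℕ → ℕ → Set
Before v a b = ∃[ i ] ∃[ j ] (i F.< j × lookup v i ≡ a × lookup v j ≡ b)

IsLinearExtension : ℕ → ℕ → List ℕ → Set
IsLinearExtension s t v =
  Unique v ×
  (∀ x → (x ∈ v) ⇔ (1 ≤ x × x ≤ s * t)) ×
  (∀ a b → a ≼[ s , t ] b → a ≢ b → Before v a b)

SameOrder : (Fin 3 → ℕ) → (Fin 3 → ℕ) → Set
SameOrder x y = ∀ p q → (x p < x q) ⇔ (y p < y q)

Contains : (Fin 3 → ℕ) → List ℕ → Set
Contains w v = ∃[ i ] ∃[ j ] ∃[ k ] (i F.< j × j F.< k ×
  SameOrder (λ { zero → lookup v i ; (suc zero) → lookup v j ; (suc (suc zero)) → lookup v k }) w)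

Avoids : (Fin 3 → ℕ) → List ℕ → Set
Avoids w v = ¬ Contains w v

w123 : Fin 3 → ℕ
w123 zero = 1
w123 (suc zero) = 2
w123 (suc (suc zero)) = 3

-- The spine step 1 ≤ 2 followed by the tooth step 2 ≤ 2 + s is a chain of three
-- elements, increasing as integers, which exists as soon as s, t ≥ 2.  Any linear
-- extension lists 1, 2, 2 + s in this order, and they form an occurrence of 123.
module Submission where

open import Defs
open import Data.Nat using (ℕ; _<_; _+_; _≤_; s≤s; z≤n)
open import Data.Nat.Properties using (<-asym; <-irrefl; <-trans; ≤-trans; m≤m+n; m<m+n; <⇒≢)
open import Data.Fin using (Fin; zero; suc)
import Data.Fin as F
import Data.Fin.Properties as F
open import Data.List using (List; _∷_; lookup)
open import Data.List.Membership.Propositional.Properties using (∈-lookup)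
open import Data.List.Relation.Unary.All as All using ()
open import Data.List.Relation.Unary.AllPairs using (_∷_)
open import Data.List.Relation.Unary.Unique.Propositional using (Unique)
open import Data.Product using (_,_)
open import Data.Empty using (⊥-elim)
open import Function.Bundles using (_⇔_; mk⇔)
import Function.Properties.Equivalence as ⇔
open import Relation.Binary.Definitions using (tri<; tri≈; tri>)
open import Relation.Binary.PropositionalEquality
  using (_≡_; refl; sym; trans; cong; subst; subst₂)
open import Relation.Binary.Construct.Closure.ReflexiveTransitive using (ε; _◅_)
open import Relation.Nullary using (¬_)

lookup-injective : ∀ {xs : List ℕ} → Unique xs →
                   ∀ i j → lookup xs i ≡ lookup xs j → i ≡ j
lookup-injective (_ ∷ _)      zero    zero    _ = refl
lookup-injective (x∉ ∷ _)     zero    (suc j) e = ⊥-elim (All.lookup x∉ (∈-lookup j) e)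
lookup-injective (x∉ ∷ _)     (suc i) zero    e = ⊥-elim (All.lookup x∉ (∈-lookup i) (sym e))
lookup-injective (_  ∷ uniq)  (suc i) (suc j) e = cong suc (lookup-injective uniq i j e)

StrictlyIncreasing : ∀ {n} → (Fin n → ℕ) → Set
StrictlyIncreasing f = ∀ {p q} → p F.< q → f p < f q

strictlyIncreasing⇒<⇔< : ∀ {n} {f : Fin n → ℕ} → StrictlyIncreasing f →
                         ∀ p q → (f p < f q) ⇔ (p F.< q)
strictlyIncreasing⇒<⇔< {f = f} incr p q = mk⇔ reflect incr
  where
  reflect : f p < f q → p F.< q
  reflect fp<fq with F.<-cmp p q
  ... | tri< p<q _ _ = p<q
  ... | tri≈ _ refl _ = ⊥-elim (<-irrefl refl fp<fq)
  ... | tri> _ _ q<p = ⊥-elim (<-asym fp<fq (incr q<p))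

triple-strictlyIncreasing : ∀ {x : Fin 3 → ℕ} →
  x zero < x (suc zero) → x (suc zero) < x (suc (suc zero)) → StrictlyIncreasing x
triple-strictlyIncreasing x₀<x₁ x₁<x₂ {zero}     {suc zero}       _ = x₀<x₁
triple-strictlyIncreasing x₀<x₁ x₁<x₂ {zero}     {suc (suc zero)} _ = <-trans x₀<x₁ x₁<x₂
triple-strictlyIncreasing x₀<x₁ x₁<x₂ {suc zero} {suc (suc zero)} _ = x₁<x₂
triple-strictlyIncreasing _ _ {_}              {zero}           ()
triple-strictlyIncreasing _ _ {suc zero}       {suc zero}       (s≤s ())
triple-strictlyIncreasing _ _ {suc (suc zero)} {suc zero}       (s≤s ())
triple-strictlyIncreasing _ _ {suc (suc zero)} {suc (suc zero)} (s≤s (s≤s ()))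

strictlyIncreasing⇒SameOrder : ∀ {x y : Fin 3 → ℕ} →
  StrictlyIncreasing x → StrictlyIncreasing y → SameOrder x y
strictlyIncreasing⇒SameOrder x↑ y↑ p q =
  ⇔.trans (strictlyIncreasing⇒<⇔< x↑ p q) (⇔.sym (strictlyIncreasing⇒<⇔< y↑ p q))

w123-strictlyIncreasing : StrictlyIncreasing w123
w123-strictlyIncreasing = triple-strictlyIncreasing (s≤s (s≤s z≤n)) (s≤s (s≤s (s≤s z≤n)))

increasingChain⇒Contains-123 : ∀ {v a b c} → Unique v →
  Before v a b → Before v b c → a < b → b < c → Contains w123 v
increasingChain⇒Contains-123 uniq (i , j , i<j , vi≡a , vj≡b) (j′ , k , j′<k , vj′≡b , vk≡c)
                             a<b b<c =
  i , j , k , i<j , subst (F._< k) j′≡j j′<k ,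
  strictlyIncreasing⇒SameOrder
    (triple-strictlyIncreasing (subst₂ _<_ (sym vi≡a) (sym vj≡b) a<b)
                               (subst₂ _<_ (sym vj≡b) (sym vk≡c) b<c))
    w123-strictlyIncreasing
  where
  j′≡j : j′ ≡ j
  j′≡j = lookup-injective uniq j′ j (trans vj′≡b (sym vj≡b))

spine-1≼2 : ∀ {s t} → 1 < s → 1 ≼[ s , t ] 2
spine-1≼2 (s≤s (s≤s _)) = spine (s≤s z≤n) (s≤s z≤n) ◅ ε

tooth-firstRow : ∀ {s t x} → 1 ≤ x → x ≤ s → 1 < t → x ≼[ s , t ] (x + s)
tooth-firstRow {s} 1≤x x≤s (s≤s (s≤s _)) = tooth 1≤x (≤-trans x≤s (m≤m+n s _)) ◅ ε

theorem3 : (s t : ℕ) → 1 < s → 1 < t →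
    (v : List ℕ) → IsLinearExtension s t v → ¬ Avoids w123 v
theorem3 s t 1<s 1<t v (uniq , _ , extends) avoids =
  avoids (increasingChain⇒Contains-123 uniq
    (extends 1 2 (spine-1≼2 1<s) (<⇒≢ 1<2))
    (extends 2 (2 + s) (tooth-firstRow (s≤s z≤n) 1<s 1<t) (<⇒≢ 2<2+s))
    1<2 2<2+s)
  where
  1<2 : 1 < 2
  1<2 = s≤s (s≤s z≤n)
  2<2+s : 2 < 2 + s
  2<2+s = m<m+n 2 (<-trans (s≤s z≤n) 1<s)
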